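{- Let $d \ge 2$ be an integer and $a \in \mathbb{C}$ such that $\bigl((d+1)a\bigr)^m = 1$, where $m$ is the smallest such positive integer. Let $p(t) = a\Bigl((d-1) - \sum_{i=1}^d 2t^i\Bigr)$. Then the sequence of column partial sums $\{S_{[k]}\}_{k\ge1}$ of $p$ is eventually periodic with period $\operatorname{lcm}(m, d+1)$ when $d$ is odd, and with period $\operatorname{lcm}(m, 2(d+1))$ when $d$ is even.
   Context: For a polynomial $p(t)$ of degree $d$ with $p(0)\ne0$, the column partial sums are, for $k \ge 1$, $$S_{[k]} = \sum_{i=0}^{(k-1)(d+1)} [t^i]\,\frac{(tp(t))^k}{1-t^{d+1}} = [t^{(k-1)(d+1)}]\,\frac{(tp(t))^k}{(1-t)(1-t^{d+1})},$$ i.e. the sum of the first $(k-1)(d+1)+1$ entries of the $k$-th column of the Riordan array $\bigl(1/(1-t^{d+1}), tp(t)\bigr)$. A sequence $\{s_k\}$ is eventually periodic with period $L$ if there exists $N$ with $s_{k+L} = s_k$ for all $k \ge N$. -}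

module Defs where

open import Level using (Level)
open import Algebra.Bundles using (CommutativeRing)
open import Data.Nat using (ℕ; zero; suc; _∸_; _≤_; _%_; _≟_; _≤?_)
import Data.Nat as ℕ
open import Data.Product using (∃)
open import Relation.Nullary using (yes; no)

-- Everything is parametrised by a commutative ring R (standing in for ℂ).
module Series {c ℓ : Level} (R : CommutativeRing c ℓ) where
  open CommutativeRing R

  -- formal power series / polynomials as coefficient sequences
  Ser : Set c
  Ser = ℕ → Carrier

  fromℕ : ℕ → Carrier
  fromℕ zero    = 0#
  fromℕ (suc n) = 1# + fromℕ n

  pow : Carrier → ℕ → Carrier
  pow x zero    = 1#
  pow x (suc n) = x * pow x n

  sumTo : ℕ → (ℕ → Carrier) → Carrier
  sumTo zero    f = f 0
  sumTo (suc n) f = sumTo n f + f (suc n)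

  _⊛_ : Ser → Ser → Ser
  (f ⊛ g) n = sumTo n (λ i → f i * g (n ∸ i))

  one : Ser
  one zero    = 1#
  one (suc _) = 0#

  powS : Ser → ℕ → Ser
  powS f zero    = one
  powS f (suc k) = f ⊛ powS f k

  -- multiplication by t
  shiftT : Ser → Ser
  shiftT f zero    = 0#
  shiftT f (suc n) = f n

  -- 1 / (1 - t^(d+1)) = Σ_j t^{j(d+1)}
  geomInv : ℕ → Ser
  geomInv d n with n % suc d ≟ 0
  ... | yes _ = 1#
  ... | no  _ = 0#

  pPoly : ℕ → Carrier → Ser
  pPoly d a zero = a * fromℕ (d ∸ 1)
  pPoly d a (suc i) with suc i ≤? d
  ... | yes _ = a * (- (1# + 1#))
  ... | no  _ = 0#

  -- S_[k] = Σ_{i=0}^{(k-1)(d+1)} [t^i] (t q(t))^k / (1 - t^{d+1})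
  -- for an arbitrary polynomial q of degree d given by its coefficients
  colPartialSum : ℕ → Ser → ℕ → Carrier
  colPartialSum d q k =
    sumTo ((k ∸ 1) ℕ.* suc d) (powS (shiftT q) k ⊛ geomInv d)

  EventuallyPeriodic : (ℕ → Carrier) → ℕ → Set ℓ
  EventuallyPeriodic s L = ∃ λ N → ∀ k → N ≤ k → s (k ℕ.+ L) ≈ s k

{-# OPTIONS --safe #-}
module Submission where

-- Write D = d + 1 and x = D a, so that p = x - 2a(1 + t + ... + t^d) and p(1) = -x. For a weight w
-- put moment w k = Σ_j w_j [t^j] (t p)^k. One more factor t p expresses moment w (k + 1) as x times
-- the moment of the shifted weight minus 2a times d + 1 further shifted moments. Hence the weight 1
-- has moment (-x)^k, the weight j has moment kD (-x)^k, and the D-periodic weight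
-- ρ j = -((-j) mod D) has moment x^k (d [k odd] + ρ k). Since [t^n] 1/(1 - t^D) counts the
-- multiples of D, D S_[k] is the moment of the weight kD - j + ρ j, that is
-- D S_[k] = x^k (d [k odd] + ρ k). As x^m = 1, D is invertible, so S_[k] is periodic with every
-- common multiple of m, 2 and D.

open import Defs
open import Level using (Level)
open import Algebra.Bundles using (CommutativeRing)
open import Data.Nat using (ℕ; suc; _≤_; _<_; _%_)
import Data.Nat as ℕ
open import Data.Nat.LCM using (lcm)
open import Data.Product using (_×_)
open import Relation.Binary.PropositionalEquality using (_≡_)

open import Data.Nat using (zero; _∸_; z≤n; s≤s; _≤?_; _≟_)
import Data.Nat.Properties as ℕ
open import Data.Nat.DivMod
  using ([m+n]%n≡m%n; m<n⇒m%n≡m; m%n<n; n%n≡0; %-pred-≡0; %-distribˡ-+; %-remove-+ˡ; %-remove-+ʳ)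
open import Data.Nat.Divisibility
  using (_∣_; divides; ∣-trans; m%n≡0⇒n∣m; n∣m⇒m%n≡0; m∣m*n; n∣m*n)
open import Data.Nat.LCM using (m∣lcm[m,n]; n∣lcm[m,n])
open import Data.Integer as ℤ using (ℤ; +_; -[1+_]; _⊖_; _◃_; sign; ∣_∣)
import Data.Integer.Properties as ℤ
open import Data.Sign as Sign using (Sign)
open import Data.Maybe using (Maybe; just; nothing)
open import Data.Product using (_,_)
open import Data.Sum using (inj₁; inj₂)
open import Relation.Nullary using (yes; no; contradiction)
import Relation.Binary.PropositionalEquality as ≡
open import Algebra.Solver.Ring.AlmostCommutativeRing
  using (fromCommutativeRing; _-Raw-AlmostCommutative⟶_)

n≤[m+n]∸o : ∀ {m n o} → o ≤ m → n ≤ (m ℕ.+ n) ∸ o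
n≤[m+n]∸o {m} {n} o≤m =
  ℕ.m+n≤o⇒m≤o∸n n (ℕ.≤-trans (ℕ.+-monoʳ-≤ n o≤m) (ℕ.≤-reflexive (ℕ.+-comm n m)))

-- The ring solver needs coefficients with a decidable equality, so we take ℤ through its canonical
-- map. The type-checking-optimised multiple n · 1# makes # 1 and # 2 reduce to 1# and 1# + 1#, so
-- solver goals match terms such as fromℕ (suc n) = 1# + fromℕ n syntactically.
module IntegerCoefficientSolver {c ℓ : Level} (R : CommutativeRing c ℓ) where
  open CommutativeRing R
  open import Algebra.Properties.Ring ring using (-1*x≈-x; -0#≈0#; -‿involutive; -‿+-comm)
  open import Algebra.Properties.Semiring.Mult.TCOptimised semiring using (×-homo-+; ×1-homo-*)
    renaming (_×_ to _·_)
  open import Algebra.Properties.CommutativeSemigroup +-commutativeSemigroup using (interchange)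
  open import Algebra.Properties.CommutativeSemigroup *-commutativeSemigroup
    using () renaming (interchange to interchange′)
  open import Relation.Binary.Reasoning.Setoid setoid

  fromSign : Sign → Carrier
  fromSign Sign.+ = 1#
  fromSign Sign.- = - 1#

  fromSign-* : ∀ s t → fromSign (s Sign.* t) ≈ fromSign s * fromSign t
  fromSign-* Sign.+ t = sym (*-identityˡ _)
  fromSign-* Sign.- Sign.+ = sym (*-identityʳ _)
  fromSign-* Sign.- Sign.- = sym (trans (-1*x≈-x (- 1#)) (-‿involutive 1#))

  fromℤ : ℤ → Carrier
  fromℤ (+ n) = n · 1#
  fromℤ -[1+ n ] = - (suc n · 1#)

  fromℤ-⊖ : ∀ m n → fromℤ (m ⊖ n) ≈ m · 1# - n · 1#
  fromℤ-⊖ zero zero = sym (-‿inverseʳ 0#)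
  fromℤ-⊖ zero (suc n) = sym (+-identityˡ _)
  fromℤ-⊖ (suc m) zero = sym (trans (+-congˡ -0#≈0#) (+-identityʳ _))
  fromℤ-⊖ (suc m) (suc n) = begin
    fromℤ (suc m ⊖ suc n)      ≡⟨ ≡.cong fromℤ (ℤ.[1+m]⊖[1+n]≡m⊖n m n) ⟩
    fromℤ (m ⊖ n)              ≈⟨ fromℤ-⊖ m n ⟩
    m · 1# - n · 1#            ≈⟨ cancel 1# (m · 1#) (n · 1#) ⟨
    (1# + m · 1#) - (1# + n · 1#) ≈⟨ +-cong (×-homo-+ 1# 1 m) (-‿cong (×-homo-+ 1# 1 n)) ⟨
    suc m · 1# - suc n · 1#    ∎
    where
    cancel : ∀ w u v → (w + u) - (w + v) ≈ u - v
    cancel w u v = begin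
      (w + u) - (w + v)      ≈⟨ +-congˡ (-‿+-comm w v) ⟨
      (w + u) + (- w - v)    ≈⟨ interchange w u (- w) (- v) ⟩
      (w - w) + (u - v)      ≈⟨ +-congʳ (-‿inverseʳ w) ⟩
      0# + (u - v)           ≈⟨ +-identityˡ _ ⟩
      u - v                  ∎

  fromℤ-+ : ∀ i j → fromℤ (i ℤ.+ j) ≈ fromℤ i + fromℤ j
  fromℤ-+ (+ m) (+ n) = ×-homo-+ 1# m n
  fromℤ-+ (+ m) -[1+ n ] = fromℤ-⊖ m (suc n)
  fromℤ-+ -[1+ m ] (+ n) = trans (fromℤ-⊖ n (suc m)) (+-comm _ _)
  fromℤ-+ -[1+ m ] -[1+ n ] = begin
    - (suc (suc (m ℕ.+ n)) · 1#)     ≡⟨ ≡.cong (λ k → - (suc k · 1#)) (ℕ.+-suc m n) ⟨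
    - ((suc m ℕ.+ suc n) · 1#)       ≈⟨ -‿cong (×-homo-+ 1# (suc m) (suc n)) ⟩
    - (suc m · 1# + suc n · 1#)      ≈⟨ -‿+-comm _ _ ⟨
    - (suc m · 1#) + - (suc n · 1#)  ∎

  fromℤ-◃ : ∀ s n → fromℤ (s ◃ n) ≈ fromSign s * n · 1#
  fromℤ-◃ s zero = sym (zeroʳ _)
  fromℤ-◃ Sign.+ (suc n) = sym (*-identityˡ _)
  fromℤ-◃ Sign.- (suc n) = sym (-1*x≈-x _)

  fromℤ-* : ∀ i j → fromℤ (i ℤ.* j) ≈ fromℤ i * fromℤ j
  fromℤ-* i j = begin
    fromℤ (sign i Sign.* sign j ◃ ∣ i ∣ ℕ.* ∣ j ∣)
      ≈⟨ fromℤ-◃ (sign i Sign.* sign j) (∣ i ∣ ℕ.* ∣ j ∣) ⟩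
    fromSign (sign i Sign.* sign j) * (∣ i ∣ ℕ.* ∣ j ∣) · 1#
      ≈⟨ *-cong (fromSign-* (sign i) (sign j)) (×1-homo-* ∣ i ∣ ∣ j ∣) ⟩
    (fromSign (sign i) * fromSign (sign j)) * (∣ i ∣ · 1# * ∣ j ∣ · 1#)
      ≈⟨ interchange′ _ _ _ _ ⟩
    (fromSign (sign i) * ∣ i ∣ · 1#) * (fromSign (sign j) * ∣ j ∣ · 1#)
      ≈⟨ *-cong (fromℤ-sign i) (fromℤ-sign j) ⟨
    fromℤ i * fromℤ j ∎
    where
    fromℤ-sign : ∀ k → fromℤ k ≈ fromSign (sign k) * ∣ k ∣ · 1#
    fromℤ-sign k = trans (reflexive (≡.cong fromℤ (≡.sym (ℤ.◃-inverse k)))) (fromℤ-◃ (sign k) ∣ k ∣)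

  fromℤ-neg : ∀ i → fromℤ (ℤ.- i) ≈ - fromℤ i
  fromℤ-neg (+ zero) = sym -0#≈0#
  fromℤ-neg (+ suc n) = refl
  fromℤ-neg -[1+ n ] = sym (-‿involutive _)

  fromℤ-homomorphism : ℤ.+-*-rawRing -Raw-AlmostCommutative⟶ fromCommutativeRing R
  fromℤ-homomorphism = record
    { ⟦_⟧ = fromℤ ; +-homo = fromℤ-+ ; *-homo = fromℤ-* ; -‿homo = fromℤ-neg
    ; 0-homo = refl ; 1-homo = refl }

  fromℤ-≟ : ∀ i j → Maybe (fromℤ i ≈ fromℤ j)
  fromℤ-≟ i j with i ℤ.≟ j
  ... | yes ≡.refl = just refl
  ... | no _ = nothing

  open import Algebra.Solver.Ring ℤ.+-*-rawRing (fromCommutativeRing R) fromℤ-homomorphism fromℤ-≟ public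

  #_ : ∀ {n} → ℕ → Polynomial n
  # k = con (+ k)

module SeriesProperties {c ℓ : Level} (R : CommutativeRing c ℓ) where
  open CommutativeRing R
  open Series R
  open IntegerCoefficientSolver R
  open import Algebra.Properties.Ring ring using (+-cancelʳ)
  open import Algebra.Properties.CommutativeSemigroup +-commutativeSemigroup using (interchange)
  open import Algebra.Properties.CommutativeSemigroup *-commutativeSemigroup using (x∙yz≈y∙xz)
  open import Relation.Binary.Reasoning.Setoid setoid

  fromℕ-+ : ∀ m n → fromℕ (m ℕ.+ n) ≈ fromℕ m + fromℕ n
  fromℕ-+ zero n = sym (+-identityˡ _)
  fromℕ-+ (suc m) n = trans (+-congˡ (fromℕ-+ m n)) (sym (+-assoc _ _ _))

  pow-+ : ∀ y i j → pow y (i ℕ.+ j) ≈ pow y i * pow y j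
  pow-+ y zero j = sym (*-identityˡ _)
  pow-+ y (suc i) j = trans (*-congˡ (pow-+ y i j)) (sym (*-assoc _ _ _))

  pow-periodic : ∀ {y m L} → pow y m ≈ 1# → m ∣ L → ∀ k → pow y (k ℕ.+ L) ≈ pow y k
  pow-periodic {y} {m} yᵐ≈1 (divides q ≡.refl) zero = pow-multiple q
    where
    pow-multiple : ∀ q → pow y (q ℕ.* m) ≈ 1#
    pow-multiple zero = refl
    pow-multiple (suc q) = trans (pow-+ y m (q ℕ.* m)) (trans (*-cong yᵐ≈1 (pow-multiple q)) (*-identityʳ 1#))
  pow-periodic yᵐ≈1 m∣L (suc k) = *-congˡ (pow-periodic yᵐ≈1 m∣L k)

  sumTo-cong : ∀ n {f g : ℕ → Carrier} → (∀ i → i ≤ n → f i ≈ g i) → sumTo n f ≈ sumTo n g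
  sumTo-cong zero f≈g = f≈g 0 z≤n
  sumTo-cong (suc n) f≈g =
    +-cong (sumTo-cong n (λ i i≤n → f≈g i (ℕ.m≤n⇒m≤1+n i≤n))) (f≈g (suc n) ℕ.≤-refl)

  sumTo-zero : ∀ n {f : ℕ → Carrier} → (∀ i → i ≤ n → f i ≈ 0#) → sumTo n f ≈ 0#
  sumTo-zero n f≈0 = trans (sumTo-cong n f≈0) (sumTo-const0 n)
    where
    sumTo-const0 : ∀ n → sumTo n (λ _ → 0#) ≈ 0#
    sumTo-const0 zero = refl
    sumTo-const0 (suc n) = trans (+-identityʳ _) (sumTo-const0 n)

  sumTo-distrib-+ : ∀ n (f g : ℕ → Carrier) →
                    sumTo n (λ i → f i + g i) ≈ sumTo n f + sumTo n g
  sumTo-distrib-+ zero f g = refl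
  sumTo-distrib-+ (suc n) f g =
    trans (+-congʳ (sumTo-distrib-+ n f g)) (interchange _ _ _ _)

  *-distribˡ-sumTo : ∀ n v (f : ℕ → Carrier) → v * sumTo n f ≈ sumTo n (λ i → v * f i)
  *-distribˡ-sumTo zero v f = refl
  *-distribˡ-sumTo (suc n) v f = trans (distribˡ _ _ _) (+-congʳ (*-distribˡ-sumTo n v f))

  *-distribʳ-sumTo : ∀ n v (f : ℕ → Carrier) → sumTo n f * v ≈ sumTo n (λ i → f i * v)
  *-distribʳ-sumTo zero v f = refl
  *-distribʳ-sumTo (suc n) v f = trans (distribʳ _ _ _) (+-congʳ (*-distribʳ-sumTo n v f))

  sumTo-unfoldˡ : ∀ n (f : ℕ → Carrier) → sumTo (suc n) f ≈ f 0 + sumTo n (λ i → f (suc i))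
  sumTo-unfoldˡ zero f = refl
  sumTo-unfoldˡ (suc n) f = trans (+-congʳ (sumTo-unfoldˡ n f)) (+-assoc _ _ _)

  sumTo-const : ∀ n v → sumTo n (λ _ → v) ≈ fromℕ (suc n) * v
  sumTo-const zero v = sym (trans (*-congʳ (+-identityʳ 1#)) (*-identityˡ v))
  sumTo-const (suc n) v = trans (+-congʳ (sumTo-const n v))
    (solve 2 (λ N w → N :* w :+ w := (# 1 :+ N) :* w) refl (fromℕ (suc n)) v)

  sumTo-truncate : ∀ {b} B {f : ℕ → Carrier} → b ≤ B → (∀ i → b < i → i ≤ B → f i ≈ 0#) →
                   sumTo B f ≈ sumTo b f
  sumTo-truncate zero z≤n _ = refl
  sumTo-truncate (suc B) b≤1+B f≈0 with ℕ.m≤n⇒m<n∨m≡n b≤1+B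
  ... | inj₂ ≡.refl = refl
  ... | inj₁ b<1+B = trans
    (+-cong (sumTo-truncate B (ℕ.≤-pred b<1+B) (λ i b<i i≤B → f≈0 i b<i (ℕ.m≤n⇒m≤1+n i≤B)))
            (f≈0 (suc B) b<1+B ℕ.≤-refl))
    (+-identityʳ _)

  sumTo-comm : ∀ m n (h : ℕ → ℕ → Carrier) →
               sumTo m (λ i → sumTo n (h i)) ≈ sumTo n (λ j → sumTo m (λ i → h i j))
  sumTo-comm zero n h = refl
  sumTo-comm (suc m) n h =
    trans (+-congʳ (sumTo-comm m n h)) (sym (sumTo-distrib-+ n _ _))

  sumTo-triangle : ∀ N (h : ℕ → ℕ → Carrier) →
                   sumTo N (λ n → sumTo n (λ i → h i (n ∸ i))) ≈ sumTo N (λ i → sumTo (N ∸ i) (h i))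
  sumTo-triangle zero h = refl
  sumTo-triangle (suc N) h = begin
    sumTo N (λ n → sumTo n (λ i → h i (n ∸ i)))
      + (sumTo N (λ i → h i (suc N ∸ i)) + h (suc N) (suc N ∸ suc N))
      ≈⟨ +-congʳ (sumTo-triangle N h) ⟩
    sumTo N (λ i → sumTo (N ∸ i) (h i)) + (sumTo N (λ i → h i (suc N ∸ i)) + h (suc N) (N ∸ N))
      ≈⟨ +-assoc _ _ _ ⟨
    (sumTo N (λ i → sumTo (N ∸ i) (h i)) + sumTo N (λ i → h i (suc N ∸ i))) + h (suc N) (N ∸ N)
      ≈⟨ +-cong (sumTo-distrib-+ N _ _) (reflexive (corner (h (suc N)))) ⟨
    sumTo N (λ i → sumTo (N ∸ i) (h i) + h i (suc N ∸ i)) + sumTo (N ∸ N) (h (suc N))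
      ≈⟨ +-congʳ (sumTo-cong N (λ i i≤N → reflexive (extend (h i) i≤N))) ⟩
    sumTo N (λ i → sumTo (suc N ∸ i) (h i)) + sumTo (suc N ∸ suc N) (h (suc N)) ∎
    where
    extend : ∀ {i} g → i ≤ N → sumTo (N ∸ i) g + g (suc N ∸ i) ≡ sumTo (suc N ∸ i) g
    extend g i≤N rewrite ℕ.+-∸-assoc 1 i≤N = ≡.refl
    corner : ∀ g → sumTo (N ∸ N) g ≡ g (N ∸ N)
    corner g rewrite ℕ.n∸n≡0 N = ≡.refl

  sumTo-shift-periodic : ∀ m {g : ℕ → Carrier} → (∀ n → g (n ℕ.+ suc m) ≈ g n) →
                         ∀ t → sumTo m (λ i → g (i ℕ.+ t)) ≈ sumTo m g
  sumTo-shift-periodic m {g} periodic zero =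
    sumTo-cong m (λ i _ → reflexive (≡.cong g (ℕ.+-identityʳ i)))
  sumTo-shift-periodic m {g} periodic (suc t) =
    trans (+-cancelʳ (h 0) _ _ rotate) (sumTo-shift-periodic m periodic t)
    where
    h : ℕ → Carrier
    h i = g (i ℕ.+ t)
    rotate : sumTo m (λ i → g (i ℕ.+ suc t)) + h 0 ≈ sumTo m h + h 0
    rotate = begin
      sumTo m (λ i → g (i ℕ.+ suc t)) + h 0
        ≈⟨ +-congʳ (sumTo-cong m (λ i _ → reflexive (≡.cong g (ℕ.+-suc i t)))) ⟩
      sumTo m (λ i → h (suc i)) + h 0   ≈⟨ +-comm _ _ ⟩
      h 0 + sumTo m (λ i → h (suc i))   ≈⟨ sumTo-unfoldˡ m h ⟨
      sumTo m h + h (suc m)             ≈⟨ +-congˡ (trans (reflexive (≡.cong g (ℕ.+-comm (suc m) t)))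
                                                          (periodic t)) ⟩
      sumTo m h + h 0                   ∎

  gauss : ∀ n → (1# + 1#) * sumTo n (λ i → fromℕ (suc i)) ≈ fromℕ (suc n) * fromℕ (suc (suc n))
  gauss zero = solve 0 (# 2 :* (# 1 :+ # 0) := (# 1 :+ # 0) :* (# 1 :+ (# 1 :+ # 0))) refl
  gauss (suc n) = trans (distribˡ _ _ _) (trans (+-congʳ (gauss n))
    (solve 1 (λ N → (# 1 :+ N) :* (# 1 :+ (# 1 :+ N)) :+ # 2 :* (# 1 :+ (# 1 :+ N))
                    := (# 1 :+ (# 1 :+ N)) :* (# 1 :+ (# 1 :+ (# 1 :+ N))))
           refl (fromℕ n)))

  DegreeAtMost : ℕ → Ser → Set ℓ
  DegreeAtMost b f = ∀ i → b < i → f i ≈ 0#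

  ⊛-degree : ∀ {b₁ b₂ f g} → DegreeAtMost b₁ f → DegreeAtMost b₂ g →
             DegreeAtMost (b₁ ℕ.+ b₂) (f ⊛ g)
  ⊛-degree {b₁} {b₂} {f} {g} deg-f deg-g n b₁+b₂<n = sumTo-zero n vanish
    where
    vanish : ∀ i → i ≤ n → f i * g (n ∸ i) ≈ 0#
    vanish i i≤n with i ≤? b₁
    ... | yes i≤b₁ = trans (*-congˡ (deg-g (n ∸ i) b₂<n∸i)) (zeroʳ _)
      where
      b₂<n∸i : b₂ < n ∸ i
      b₂<n∸i = ℕ.≤-<-trans (n≤[m+n]∸o i≤b₁)
                           (ℕ.∸-monoˡ-< b₁+b₂<n (ℕ.≤-trans i≤b₁ (ℕ.m≤m+n b₁ b₂)))
    ... | no i≰b₁ = trans (*-congʳ (deg-f i (ℕ.≰⇒> i≰b₁))) (zeroˡ _)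

  sumTo-⊛ : ∀ N (f g : Ser) → sumTo N (f ⊛ g) ≈ sumTo N (λ i → f i * sumTo (N ∸ i) g)
  sumTo-⊛ N f g = trans (sumTo-triangle N (λ i j → f i * g j))
                        (sumTo-cong N (λ i _ → sym (*-distribˡ-sumTo (N ∸ i) (f i) g)))

  weighted-⊛ : ∀ {b₁ b₂ f g} → DegreeAtMost b₁ f → DegreeAtMost b₂ g → ∀ (w : ℕ → Carrier) →
               sumTo (b₁ ℕ.+ b₂) (λ n → w n * (f ⊛ g) n) ≈
               sumTo b₁ (λ i → f i * sumTo b₂ (λ j → w (i ℕ.+ j) * g j))
  weighted-⊛ {b₁} {b₂} {f} {g} deg-f deg-g w = begin
    sumTo B (λ n → w n * (f ⊛ g) n)
      ≈⟨ sumTo-cong B (λ n _ → trans (*-distribˡ-sumTo n (w n) _) (sumTo-cong n (regroup n))) ⟩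
    sumTo B (λ n → sumTo n (λ i → h i (n ∸ i)))
      ≈⟨ sumTo-triangle B h ⟩
    sumTo B (λ i → sumTo (B ∸ i) (h i))
      ≈⟨ sumTo-truncate B (ℕ.m≤m+n b₁ b₂)
           (λ i b₁<i _ → sumTo-zero (B ∸ i) (λ j _ → h-vanishesˡ i j b₁<i)) ⟩
    sumTo b₁ (λ i → sumTo (B ∸ i) (h i))
      ≈⟨ sumTo-cong b₁ (λ i i≤b₁ → sumTo-truncate (B ∸ i) (n≤[m+n]∸o i≤b₁)
                                     (λ j b₂<j _ → h-vanishesʳ i j b₂<j)) ⟩
    sumTo b₁ (λ i → sumTo b₂ (h i))
      ≈⟨ sumTo-cong b₁ (λ i _ → *-distribˡ-sumTo b₂ (f i) _) ⟨
    sumTo b₁ (λ i → f i * sumTo b₂ (λ j → w (i ℕ.+ j) * g j)) ∎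
    where
    B : ℕ
    B = b₁ ℕ.+ b₂
    h : ℕ → ℕ → Carrier
    h i j = f i * (w (i ℕ.+ j) * g j)
    regroup : ∀ n i → i ≤ n → w n * (f i * g (n ∸ i)) ≈ h i (n ∸ i)
    regroup n i i≤n = trans (*-congʳ (reflexive (≡.cong w (≡.sym (ℕ.m+[n∸m]≡n i≤n))))) (x∙yz≈y∙xz _ _ _)
    h-vanishesˡ : ∀ i j → b₁ < i → h i j ≈ 0#
    h-vanishesˡ i j b₁<i = trans (*-congʳ (deg-f i b₁<i)) (zeroˡ _)
    h-vanishesʳ : ∀ i j → b₂ < j → h i j ≈ 0#
    h-vanishesʳ i j b₂<j = trans (*-congˡ (trans (*-congˡ (deg-g j b₂<j)) (zeroʳ _))) (zeroʳ _)

module ColumnSums {c ℓ : Level} (R : CommutativeRing c ℓ) (e : ℕ) (a : CommutativeRing.Carrier R) where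
  open CommutativeRing R
  open Series R
  open SeriesProperties R
  open IntegerCoefficientSolver R
  open import Algebra.Properties.Ring ring using (-0#≈0#; -1*x≈-x)
  open import Algebra.Properties.CommutativeSemigroup *-commutativeSemigroup using (x∙yz≈xz∙y)
  open import Relation.Binary.Reasoning.Setoid setoid

  d D : ℕ
  d = suc e
  D = suc d

  two x : Carrier
  two = 1# + 1#
  x = fromℕ D * a

  p tp : Ser
  p = pPoly d a
  tp = shiftT p

  tpPow : ℕ → Ser
  tpPow = powS tp

  p-suc : ∀ i → suc i ≤ d → p (suc i) ≈ a * - two
  p-suc i i<d with suc i ≤? d
  ... | yes _ = refl
  ... | no i≮d = contradiction i<d i≮d

  tp-degree : DegreeAtMost D tp
  tp-degree (suc zero) (s≤s ())
  tp-degree (suc (suc i)) (s≤s D≤1+i) with suc i ≤? d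
  ... | yes 1+i≤d = contradiction (ℕ.≤-trans D≤1+i 1+i≤d) (ℕ.<-irrefl ≡.refl)
  ... | no _ = refl

  tpPow-degree : ∀ k → DegreeAtMost (k ℕ.* D) (tpPow k)
  tpPow-degree zero (suc i) _ = refl
  tpPow-degree (suc k) = ⊛-degree tp-degree (tpPow-degree k)

  p-weighted : ∀ (X : ℕ → Carrier) → sumTo d (λ i → p i * X i) ≈ x * X 0 - two * a * sumTo d X
  p-weighted X = begin
    sumTo d (λ i → p i * X i)
      ≈⟨ sumTo-unfoldˡ e _ ⟩
    a * fromℕ e * X 0 + sumTo e (λ i → p (suc i) * X (suc i))
      ≈⟨ +-congˡ (sumTo-cong e (λ i i<d → *-congʳ (p-suc i (s≤s i<d)))) ⟩
    a * fromℕ e * X 0 + sumTo e (λ i → a * - two * X (suc i))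
      ≈⟨ +-congˡ (*-distribˡ-sumTo e _ _) ⟨
    a * fromℕ e * X 0 + a * - two * sumTo e (λ i → X (suc i))
      ≈⟨ solve 4 (λ A E X₀ Σ → A :* E :* X₀ :+ A :* :- # 2 :* Σ
                               := (# 1 :+ (# 1 :+ E)) :* A :* X₀ :- # 2 :* A :* (X₀ :+ Σ))
               refl a (fromℕ e) (X 0) (sumTo e (λ i → X (suc i))) ⟩
    x * X 0 - two * a * (X 0 + sumTo e (λ i → X (suc i)))
      ≈⟨ +-congˡ (-‿cong (*-congˡ (sumTo-unfoldˡ e X))) ⟨
    x * X 0 - two * a * sumTo d X ∎

  tp-weighted : ∀ (Y : ℕ → Carrier) →
                sumTo D (λ i → tp i * Y i) ≈ x * Y 1 - two * a * sumTo d (λ i → Y (suc i))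
  tp-weighted Y = begin
    sumTo D (λ i → tp i * Y i)                    ≈⟨ sumTo-unfoldˡ d _ ⟩
    0# * Y 0 + sumTo d (λ i → p i * Y (suc i))    ≈⟨ trans (+-congʳ (zeroˡ _)) (+-identityˡ _) ⟩
    sumTo d (λ i → p i * Y (suc i))               ≈⟨ p-weighted (λ i → Y (suc i)) ⟩
    x * Y 1 - two * a * sumTo d (λ i → Y (suc i)) ∎

  moment : (ℕ → Carrier) → ℕ → Carrier
  moment w k = sumTo (k ℕ.* D) (λ j → w j * tpPow k j)

  moment-cong : ∀ k {w w′ : ℕ → Carrier} → (∀ j → w j ≈ w′ j) → moment w k ≈ moment w′ k
  moment-cong k w≈w′ = sumTo-cong (k ℕ.* D) (λ j _ → *-congʳ (w≈w′ j))

  moment-+ : ∀ k (w w′ : ℕ → Carrier) → moment (λ j → w j + w′ j) k ≈ moment w k + moment w′ k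
  moment-+ k w w′ = trans (sumTo-cong (k ℕ.* D) (λ j _ → distribʳ _ _ _)) (sumTo-distrib-+ (k ℕ.* D) _ _)

  moment-*ˡ : ∀ k v (w : ℕ → Carrier) → moment (λ j → v * w j) k ≈ v * moment w k
  moment-*ˡ k v w =
    trans (sumTo-cong (k ℕ.* D) (λ j _ → *-assoc _ _ _)) (sym (*-distribˡ-sumTo (k ℕ.* D) v _))

  moment-sumTo : ∀ n k (w : ℕ → ℕ → Carrier) →
                 sumTo n (λ i → moment (w i) k) ≈ moment (λ j → sumTo n (λ i → w i j)) k
  moment-sumTo n k w = trans (sumTo-comm n (k ℕ.* D) _)
    (sumTo-cong (k ℕ.* D) (λ j _ → sym (*-distribʳ-sumTo n (tpPow k j) (λ i → w i j))))

  moment-suc : ∀ (w : ℕ → Carrier) k →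
               moment w (suc k) ≈ x * moment (λ j → w (suc j)) k
                                  - two * a * sumTo d (λ i → moment (λ j → w (suc i ℕ.+ j)) k)
  moment-suc w k = trans (weighted-⊛ tp-degree (tpPow-degree k) w)
                         (tp-weighted (λ i → moment (λ j → w (i ℕ.+ j)) k))

  moment-one : ∀ k → moment (λ _ → 1#) k ≈ pow (- x) k
  moment-one zero = *-identityˡ 1#
  moment-one (suc k) = begin
    moment (λ _ → 1#) (suc k)                  ≈⟨ moment-suc _ k ⟩
    x * E - two * a * sumTo d (λ _ → E)        ≈⟨ +-congˡ (-‿cong (*-congˡ (sumTo-const d E))) ⟩
    x * E - two * a * (fromℕ D * E)            ≈⟨ solve 3 (λ N A E → N :* A :* E :- # 2 :* A :* (N :* E)
                                                              := :- (N :* A) :* E) refl (fromℕ D) a E ⟩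
    - x * E                                    ≈⟨ *-congˡ (moment-one k) ⟩
    pow (- x) (suc k)                          ∎
    where
    E : Carrier
    E = moment (λ _ → 1#) k

  moment-const : ∀ k v → moment (λ _ → v) k ≈ v * pow (- x) k
  moment-const k v = begin
    moment (λ _ → v) k         ≈⟨ moment-cong k (λ _ → *-identityʳ v) ⟨
    moment (λ _ → v * 1#) k    ≈⟨ moment-*ˡ k v _ ⟩
    v * moment (λ _ → 1#) k    ≈⟨ *-congˡ (moment-one k) ⟩
    v * pow (- x) k            ∎

  moment-shift : ∀ k t → moment (λ j → fromℕ (t ℕ.+ j)) k ≈ fromℕ t * pow (- x) k + moment fromℕ k
  moment-shift k t = begin
    moment (λ j → fromℕ (t ℕ.+ j)) k              ≈⟨ moment-cong k (fromℕ-+ t) ⟩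
    moment (λ j → fromℕ t + fromℕ j) k            ≈⟨ moment-+ k _ _ ⟩
    moment (λ _ → fromℕ t) k + moment fromℕ k     ≈⟨ +-congʳ (moment-const k (fromℕ t)) ⟩
    fromℕ t * pow (- x) k + moment fromℕ k        ∎

  moment-fromℕ : ∀ k → moment fromℕ k ≈ fromℕ (k ℕ.* D) * pow (- x) k
  moment-fromℕ zero = refl
  moment-fromℕ (suc k) = begin
    moment fromℕ (suc k)
      ≈⟨ moment-suc fromℕ k ⟩
    x * moment (λ j → fromℕ (1 ℕ.+ j)) k
      - two * a * sumTo d (λ i → moment (λ j → fromℕ (suc i ℕ.+ j)) k)
      ≈⟨ +-cong (*-congˡ (shifted 1)) (-‿cong (*-congˡ (sumTo-cong d (λ i _ → shifted (suc i))))) ⟩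
    x * (fromℕ 1 * E + N * E) - two * a * sumTo d (λ i → fromℕ (suc i) * E + N * E)
      ≈⟨ +-congˡ (-‿cong (*-congˡ (trans (sumTo-distrib-+ d _ _)
                                         (+-cong (sym (*-distribʳ-sumTo d E _)) (sumTo-const d (N * E)))))) ⟩
    x * (fromℕ 1 * E + N * E) - two * a * (T * E + fromℕ D * (N * E))
      ≈⟨ solve 5 (λ N′ A E′ N T′ → N′ :* A :* ((# 1 :+ # 0) :* E′ :+ N :* E′)
                                   :- # 2 :* A :* (T′ :* E′ :+ N′ :* (N :* E′))
                                   := N′ :* A :* (E′ :+ N :* E′) :- A :* E′ :* (# 2 :* T′)
                                      :- # 2 :* A :* N′ :* N :* E′)
               refl (fromℕ D) a E N T ⟩
    x * (E + N * E) - a * E * (two * T) - two * a * fromℕ D * N * E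
      ≈⟨ +-congʳ (+-congˡ (-‿cong (*-congˡ (gauss d)))) ⟩
    x * (E + N * E) - a * E * (fromℕ D * fromℕ (suc D)) - two * a * fromℕ D * N * E
      ≈⟨ solve 4 (λ N′ A E′ N → N′ :* A :* (E′ :+ N :* E′) :- A :* E′ :* (N′ :* (# 1 :+ N′))
                                 :- # 2 :* A :* N′ :* N :* E′
                                 := (N′ :+ N) :* (:- (N′ :* A) :* E′))
               refl (fromℕ D) a E N ⟩
    (fromℕ D + N) * (- x * E)
      ≈⟨ *-congʳ (fromℕ-+ D (k ℕ.* D)) ⟨
    fromℕ (suc k ℕ.* D) * pow (- x) (suc k) ∎
    where
    E N T : Carrier
    E = pow (- x) k
    N = fromℕ (k ℕ.* D)
    T = sumTo d (λ i → fromℕ (suc i))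
    shifted : ∀ t → moment (λ j → fromℕ (t ℕ.+ j)) k ≈ fromℕ t * E + N * E
    shifted t = trans (moment-shift k t) (+-congˡ (moment-fromℕ k))

  parity : ℕ → Carrier
  parity zero = 0#
  parity (suc k) = 1# - parity k

  pow-neg : ∀ k → pow (- x) k ≈ (1# - two * parity k) * pow x k
  pow-neg zero = solve 0 (# 1 := (# 1 :- # 2 :* # 0) :* # 1) refl
  pow-neg (suc k) = trans (*-congˡ (pow-neg k))
    (solve 3 (λ X P q → :- X :* ((# 1 :- # 2 :* q) :* P) := (# 1 :- # 2 :* (# 1 :- q)) :* (X :* P))
           refl x (pow x k) (parity k))

  -- ρ n = -((-n) mod D), the representative of n mod D in (-D, 0].
  ρ₀ : ℕ → Carrier
  ρ₀ zero = 0#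
  ρ₀ (suc r) = fromℕ (suc r) - fromℕ D

  ρ : ℕ → Carrier
  ρ n = ρ₀ (n % D)

  ρ-periodic : ∀ n → ρ (n ℕ.+ D) ≈ ρ n
  ρ-periodic n = reflexive (≡.cong ρ₀ ([m+n]%n≡m%n n D))

  ρ-sum : two * a * sumTo d ρ ≈ - (fromℕ d * x)
  ρ-sum = begin
    two * a * sumTo d ρ
      ≈⟨ *-congˡ (sumTo-unfoldˡ e ρ) ⟩
    two * a * (0# + sumTo e (λ i → ρ (suc i)))
      ≈⟨ *-congˡ (+-congˡ (sumTo-cong e (λ i i≤e → reflexive (≡.cong ρ₀ (m<n⇒m%n≡m (s≤s (s≤s i≤e))))))) ⟩
    two * a * (0# + sumTo e (λ i → fromℕ (suc i) - fromℕ D))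
      ≈⟨ *-congˡ (+-congˡ (trans (sumTo-distrib-+ e _ _) (+-congˡ (sumTo-const e (- fromℕ D))))) ⟩
    two * a * (0# + (T + fromℕ d * - fromℕ D))
      ≈⟨ solve 4 (λ A T′ M N → # 2 :* A :* (# 0 :+ (T′ :+ M :* :- N))
                               := A :* (# 2 :* T′) :- # 2 :* A :* M :* N) refl a T (fromℕ d) (fromℕ D) ⟩
    a * (two * T) - two * a * fromℕ d * fromℕ D
      ≈⟨ +-congʳ (*-congˡ (gauss e)) ⟩
    a * (fromℕ d * fromℕ D) - two * a * fromℕ d * fromℕ D
      ≈⟨ solve 3 (λ A M N → A :* (M :* N) :- # 2 :* A :* M :* N := :- (M :* (N :* A)))
               refl a (fromℕ d) (fromℕ D) ⟩
    - (fromℕ d * x) ∎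
    where
    T : Carrier
    T = sumTo e (λ i → fromℕ (suc i))

  moment-ρ : ∀ k s → moment (λ j → ρ (j ℕ.+ s)) k ≈ pow x k * (fromℕ d * parity k + ρ (k ℕ.+ s))
  moment-ρ zero s = solve 2 (λ M r → r :* # 1 := # 1 :* (M :* # 0 :+ r)) refl (fromℕ d) (ρ s)
  moment-ρ (suc k) s = begin
    moment (λ j → ρ (j ℕ.+ s)) (suc k)
      ≈⟨ moment-suc _ k ⟩
    x * moment (λ j → ρ (suc j ℕ.+ s)) k
      - two * a * sumTo d (λ i → moment (λ j → ρ (suc i ℕ.+ j ℕ.+ s)) k)
      ≈⟨ +-cong (*-congˡ (moment-cong k (λ j → reflexive (≡.cong ρ (≡.sym (ℕ.+-suc j s))))))
                (-‿cong (*-congˡ window)) ⟩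
    x * moment (λ j → ρ (j ℕ.+ suc s)) k - two * a * (sumTo d ρ * pow (- x) k)
      ≈⟨ +-cong (*-congˡ (moment-ρ k (suc s)))
                (-‿cong (trans (sym (*-assoc _ _ _)) (*-cong ρ-sum (pow-neg k)))) ⟩
    x * (pow x k * (fromℕ d * parity k + r)) - - (fromℕ d * x) * ((1# - two * parity k) * pow x k)
      ≈⟨ solve 5 (λ X P M q r′ → X :* (P :* (M :* q :+ r′)) :- :- (M :* X) :* ((# 1 :- # 2 :* q) :* P)
                                 := X :* P :* (M :* (# 1 :- q) :+ r′))
               refl x (pow x k) (fromℕ d) (parity k) r ⟩
    pow x (suc k) * (fromℕ d * parity (suc k) + r)
      ≈⟨ *-congˡ (+-congˡ (reflexive (≡.cong ρ (ℕ.+-suc k s)))) ⟩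
    pow x (suc k) * (fromℕ d * parity (suc k) + ρ (suc k ℕ.+ s)) ∎
    where
    r : Carrier
    r = ρ (k ℕ.+ suc s)
    window : sumTo d (λ i → moment (λ j → ρ (suc i ℕ.+ j ℕ.+ s)) k) ≈ sumTo d ρ * pow (- x) k
    window = begin
      sumTo d (λ i → moment (λ j → ρ (suc i ℕ.+ j ℕ.+ s)) k)
        ≈⟨ moment-sumTo d k _ ⟩
      moment (λ j → sumTo d (λ i → ρ (suc i ℕ.+ j ℕ.+ s))) k
        ≈⟨ moment-cong k (λ j → trans (sumTo-cong d (λ i _ → reflexive (≡.cong ρ (reassoc i j))))
                                      (sumTo-shift-periodic d ρ-periodic (suc j ℕ.+ s))) ⟩
      moment (λ _ → sumTo d ρ) k
        ≈⟨ moment-const k _ ⟩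
      sumTo d ρ * pow (- x) k ∎
      where
      reassoc : ∀ i j → suc i ℕ.+ j ℕ.+ s ≡ i ℕ.+ (suc j ℕ.+ s)
      reassoc i j = ≡.trans (ℕ.+-assoc (suc i) j s) (≡.sym (ℕ.+-suc i (j ℕ.+ s)))

  count-multiples : ∀ M → fromℕ D * sumTo M (geomInv d) ≈ fromℕ (M ℕ.+ D) - fromℕ (M % D)
  count-multiples zero = trans (*-identityʳ _) (sym (trans (+-congˡ -0#≈0#) (+-identityʳ _)))
  count-multiples (suc M) with suc M % D ≟ 0
  ... | yes [1+M]%D≡0 = begin
    fromℕ D * (sumTo M (geomInv d) + 1#)
      ≈⟨ trans (distribˡ _ _ _) (+-cong (count-multiples M) (*-identityʳ _)) ⟩
    fromℕ (M ℕ.+ D) - fromℕ (M % D) + fromℕ D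
      ≈⟨ +-congʳ (+-congˡ (-‿cong (reflexive (≡.cong fromℕ (%-pred-≡0 {M} {D} [1+M]%D≡0))))) ⟩
    fromℕ (M ℕ.+ D) - fromℕ d + (1# + fromℕ d)
      ≈⟨ solve 2 (λ A B → A :- B :+ (# 1 :+ B) := (# 1 :+ A) :- # 0) refl (fromℕ (M ℕ.+ D)) (fromℕ d) ⟩
    fromℕ (suc M ℕ.+ D) - 0#
      ≈⟨ +-congˡ (-‿cong (reflexive (≡.cong fromℕ (≡.sym [1+M]%D≡0)))) ⟩
    fromℕ (suc M ℕ.+ D) - fromℕ (suc M % D) ∎
  ... | no [1+M]%D≢0 = begin
    fromℕ D * (sumTo M (geomInv d) + 0#)
      ≈⟨ trans (*-congˡ (+-identityʳ _)) (count-multiples M) ⟩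
    fromℕ (M ℕ.+ D) - fromℕ (M % D)
      ≈⟨ solve 2 (λ A B → A :- B := (# 1 :+ A) :- (# 1 :+ B)) refl (fromℕ (M ℕ.+ D)) (fromℕ (M % D)) ⟩
    fromℕ (suc M ℕ.+ D) - (1# + fromℕ (M % D))
      ≈⟨ +-congˡ (-‿cong (reflexive (≡.cong fromℕ (≡.sym [1+M]%D≡1+M%D)))) ⟩
    fromℕ (suc M ℕ.+ D) - fromℕ (suc M % D) ∎
    where
    [1+M]%D≡1+M%D : suc M % D ≡ suc (M % D)
    [1+M]%D≡1+M%D with ℕ.m≤n⇒m<n∨m≡n (m%n<n M D)
    ... | inj₁ 1+M%D<D = ≡.trans (%-distribˡ-+ 1 M D) (m<n⇒m%n≡m 1+M%D<D)
    ... | inj₂ 1+M%D≡D = contradiction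
      (≡.trans (%-distribˡ-+ 1 M D) (≡.trans (≡.cong (_% D) 1+M%D≡D) (n%n≡0 D))) [1+M]%D≢0

  residue-complement : ∀ u v → D ∣ u ℕ.+ v → - fromℕ (u % D) ≈ ρ v
  residue-complement u v D∣u+v = complement (u % D) (v % D) (m%n<n u D) (m%n<n v D)
    (≡.trans (≡.sym (%-distribˡ-+ u v D)) (n∣m⇒m%n≡0 _ D D∣u+v))
    where
    complement : ∀ r s → r < D → s < D → (r ℕ.+ s) % D ≡ 0 → - fromℕ r ≈ ρ₀ s
    complement r zero r<D _ r+0%D≡0 =
      trans (-‿cong (reflexive (≡.cong fromℕ r≡0))) -0#≈0#
      where
      r≡0 : r ≡ 0
      r≡0 = ≡.trans (≡.sym (m<n⇒m%n≡m r<D)) (≡.trans (≡.cong (_% D) (≡.sym (ℕ.+-identityʳ r))) r+0%D≡0)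
    complement r (suc s) r<D 1+s<D r+1+s%D≡0 = begin
      - fromℕ r
        ≈⟨ solve 2 (λ A B → :- A := B :- (A :+ B)) refl (fromℕ r) (fromℕ (suc s)) ⟩
      fromℕ (suc s) - (fromℕ r + fromℕ (suc s))
        ≈⟨ +-congˡ (-‿cong (fromℕ-+ r (suc s))) ⟨
      fromℕ (suc s) - fromℕ (r ℕ.+ suc s)
        ≡⟨ ≡.cong (λ n → fromℕ (suc s) - fromℕ n) r+1+s≡D ⟩
      fromℕ (suc s) - fromℕ D ∎
      where
      r+1+s≡D : r ℕ.+ suc s ≡ D
      r+1+s≡D with m%n≡0⇒n∣m _ D r+1+s%D≡0
      ... | divides zero r+1+s≡0 = contradiction (≡.trans (≡.sym (ℕ.+-suc r s)) r+1+s≡0) λ ()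
      ... | divides 1 r+1+s≡D+0 = ≡.trans r+1+s≡D+0 (ℕ.+-identityʳ D)
      ... | divides (suc (suc q)) r+1+s≡[2+q]D = contradiction (ℕ.+-mono-<-≤ r<D (ℕ.<⇒≤ 1+s<D))
        (ℕ.≤⇒≯ (ℕ.≤-trans (ℕ.+-monoʳ-≤ D (ℕ.m≤m+n D (q ℕ.* D)))
                          (ℕ.≤-reflexive (≡.sym r+1+s≡[2+q]D))))

  ρ-top : ∀ {N s} → D ∣ N → 0 < s → s ≤ D → ρ (N ℕ.+ s) ≈ fromℕ s - fromℕ D
  ρ-top {N} {suc t} D∣N _ 1+t≤D with ℕ.m≤n⇒m<n∨m≡n 1+t≤D
  ... | inj₁ 1+t<D = reflexive (≡.cong ρ₀ (≡.trans (%-remove-+ˡ (suc t) D∣N) (m<n⇒m%n≡m 1+t<D)))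
  ... | inj₂ ≡.refl = begin
    ρ (N ℕ.+ D)      ≡⟨ ≡.cong ρ₀ (≡.trans (%-remove-+ˡ D D∣N) (n%n≡0 D)) ⟩
    0#               ≈⟨ -‿inverseʳ (fromℕ D) ⟨
    fromℕ D - fromℕ D ∎

  weight : ℕ → ℕ → Carrier
  weight N i = fromℕ (D ℕ.+ N) - fromℕ i + ρ i

  count-weight : ∀ {N i} → D ∣ N → i ≤ N → fromℕ D * sumTo (N ∸ i) (geomInv d) ≈ weight N i
  count-weight {N} {i} D∣N i≤N = begin
    fromℕ D * sumTo (N ∸ i) (geomInv d)
      ≈⟨ count-multiples (N ∸ i) ⟩
    fromℕ (N ∸ i ℕ.+ D) - fromℕ ((N ∸ i) % D)
      ≈⟨ +-cong (fromℕ-+ (N ∸ i) D) (residue-complement (N ∸ i) i D∣N∸i+i) ⟩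
    fromℕ (N ∸ i) + fromℕ D + ρ i
      ≈⟨ +-congʳ (solve 3 (λ A B C → A :+ B := B :+ (A :+ C) :- C)
                          refl (fromℕ (N ∸ i)) (fromℕ D) (fromℕ i)) ⟩
    fromℕ D + (fromℕ (N ∸ i) + fromℕ i) - fromℕ i + ρ i
      ≈⟨ +-congʳ (+-congʳ (trans (+-congˡ N∸i+i) (sym (fromℕ-+ D N)))) ⟩
    weight N i ∎
    where
    D∣N∸i+i : D ∣ N ∸ i ℕ.+ i
    D∣N∸i+i = ≡.subst (D ∣_) (≡.sym (ℕ.m∸n+n≡m i≤N)) D∣N
    N∸i+i : fromℕ (N ∸ i) + fromℕ i ≈ fromℕ N
    N∸i+i = trans (sym (fromℕ-+ (N ∸ i) i)) (reflexive (≡.cong fromℕ (ℕ.m∸n+n≡m i≤N)))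

  weight-vanishes : ∀ {N i} → D ∣ N → N < i → i ≤ D ℕ.+ N → weight N i ≈ 0#
  weight-vanishes {N} D∣N N<i i≤D+N with s , ≡.refl ← ℕ.m≤n⇒∃[o]m+o≡n (ℕ.<⇒≤ N<i) = begin
    fromℕ (D ℕ.+ N) - fromℕ (N ℕ.+ s) + ρ (N ℕ.+ s)
      ≈⟨ +-cong (+-cong (fromℕ-+ D N) (-‿cong (fromℕ-+ N s))) (ρ-top D∣N 0<s s≤D) ⟩
    (fromℕ D + fromℕ N) - (fromℕ N + fromℕ s) + (fromℕ s - fromℕ D)
      ≈⟨ solve 3 (λ A B C → (A :+ B) :- (B :+ C) :+ (C :- A) := # 0) refl (fromℕ D) (fromℕ N) (fromℕ s) ⟩
    0# ∎
    where
    0<s : 0 < s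
    0<s = ℕ.+-cancelˡ-< N 0 s (≡.subst (_< N ℕ.+ s) (≡.sym (ℕ.+-identityʳ N)) N<i)
    s≤D : s ≤ D
    s≤D = ℕ.+-cancelˡ-≤ N s D (≡.subst (N ℕ.+ s ≤_) (ℕ.+-comm D N) i≤D+N)

  S : ℕ → Carrier
  S = colPartialSum d p

  column-sum-as-moment : ∀ n → fromℕ D * S (suc n) ≈ moment (weight (n ℕ.* D)) (suc n)
  column-sum-as-moment n = begin
    fromℕ D * sumTo N (F ⊛ geomInv d)
      ≈⟨ *-congˡ (sumTo-⊛ N F (geomInv d)) ⟩
    fromℕ D * sumTo N (λ i → F i * sumTo (N ∸ i) (geomInv d))
      ≈⟨ *-distribˡ-sumTo N _ _ ⟩
    sumTo N (λ i → fromℕ D * (F i * sumTo (N ∸ i) (geomInv d)))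
      ≈⟨ sumTo-cong N (λ i i≤N → trans (x∙yz≈xz∙y _ _ _) (*-congʳ (count-weight D∣N i≤N))) ⟩
    sumTo N (λ i → weight N i * F i)
      ≈⟨ sumTo-truncate (D ℕ.+ N) (ℕ.m≤n+m N D)
           (λ i N<i i≤D+N → trans (*-congʳ (weight-vanishes D∣N N<i i≤D+N)) (zeroˡ _)) ⟨
    moment (weight N) (suc n) ∎
    where
    N : ℕ
    N = n ℕ.* D
    F : Ser
    F = tpPow (suc n)
    D∣N : D ∣ N
    D∣N = n∣m*n n

  moment-mean : ∀ k → moment (λ j → fromℕ (k ℕ.* D) - fromℕ j) k ≈ 0#
  moment-mean k = begin
    moment (λ j → fromℕ (k ℕ.* D) - fromℕ j) k
      ≈⟨ moment-+ k _ _ ⟩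
    moment (λ _ → fromℕ (k ℕ.* D)) k + moment (λ j → - fromℕ j) k
      ≈⟨ +-cong (moment-const k _)
                (trans (moment-cong k (λ j → sym (-1*x≈-x _))) (moment-*ˡ k (- 1#) fromℕ)) ⟩
    fromℕ (k ℕ.* D) * pow (- x) k + - 1# * moment fromℕ k
      ≈⟨ +-congˡ (*-congˡ (moment-fromℕ k)) ⟩
    fromℕ (k ℕ.* D) * pow (- x) k + - 1# * (fromℕ (k ℕ.* D) * pow (- x) k)
      ≈⟨ solve 2 (λ N E → N :* E :+ :- # 1 :* (N :* E) := # 0) refl (fromℕ (k ℕ.* D)) (pow (- x) k) ⟩
    0# ∎

  closedForm : ℕ → Carrier
  closedForm k = pow x k * (fromℕ d * parity k + ρ k)

  column-sum-closed-form : ∀ n → fromℕ D * S (suc n) ≈ closedForm (suc n)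
  column-sum-closed-form n = begin
    fromℕ D * S k
      ≈⟨ column-sum-as-moment n ⟩
    moment (weight (n ℕ.* D)) k
      ≈⟨ moment-+ k _ _ ⟩
    moment (λ j → fromℕ (k ℕ.* D) - fromℕ j) k + moment ρ k
      ≈⟨ +-cong (moment-mean k) (moment-cong k (λ j → reflexive (≡.cong ρ (≡.sym (ℕ.+-identityʳ j))))) ⟩
    0# + moment (λ j → ρ (j ℕ.+ 0)) k
      ≈⟨ trans (+-identityˡ _) (moment-ρ k 0) ⟩
    pow x k * (fromℕ d * parity k + ρ (k ℕ.+ 0))
      ≡⟨ ≡.cong (λ r → pow x k * (fromℕ d * parity k + ρ r)) (ℕ.+-identityʳ k) ⟩
    closedForm k ∎
    where
    k : ℕ
    k = suc n

  parity-periodic : ∀ {L} → 2 ∣ L → ∀ k → parity (k ℕ.+ L) ≈ parity k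
  parity-periodic (divides q ≡.refl) zero = parity-even q
    where
    parity-even : ∀ q → parity (q ℕ.* 2) ≈ 0#
    parity-even zero = refl
    parity-even (suc q) = trans (solve 1 (λ P → # 1 :- (# 1 :- P) := P) refl (parity (q ℕ.* 2))) (parity-even q)
  parity-periodic 2∣L (suc k) = +-congˡ (-‿cong (parity-periodic 2∣L k))

  closedForm-periodic : ∀ {m L} → pow x m ≈ 1# → m ∣ L → 2 ∣ L → D ∣ L →
                        ∀ k → closedForm (k ℕ.+ L) ≈ closedForm k
  closedForm-periodic xᵐ≈1 m∣L 2∣L D∣L k =
    *-cong (pow-periodic xᵐ≈1 m∣L k)
           (+-cong (*-congˡ (parity-periodic 2∣L k)) (reflexive (≡.cong ρ₀ (%-remove-+ʳ k D∣L))))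

  column-sums-periodic : ∀ {m L} → 0 < m → pow x m ≈ 1# → m ∣ L → 2 ∣ L → D ∣ L →
                         EventuallyPeriodic S L
  column-sums-periodic {m} {L} 0<m xᵐ≈1 m∣L 2∣L D∣L = 1 , periodic
    where
    D⁻¹ : Carrier
    D⁻¹ = a * pow x (m ∸ 1)
    D⁻¹-inverse : D⁻¹ * fromℕ D ≈ 1#
    D⁻¹-inverse = begin
      a * pow x (m ∸ 1) * fromℕ D   ≈⟨ solve 3 (λ A P N → A :* P :* N := N :* A :* P)
                                               refl a (pow x (m ∸ 1)) (fromℕ D) ⟩
      x * pow x (m ∸ 1)             ≡⟨ ≡.cong (pow x) (ℕ.suc-pred m {{ℕ.>-nonZero 0<m}}) ⟩
      pow x m                       ≈⟨ xᵐ≈1 ⟩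
      1#                            ∎
    S≈ : ∀ n → S (suc n) ≈ D⁻¹ * closedForm (suc n)
    S≈ n = begin
      S (suc n)                      ≈⟨ *-identityˡ _ ⟨
      1# * S (suc n)                 ≈⟨ *-congʳ D⁻¹-inverse ⟨
      D⁻¹ * fromℕ D * S (suc n)      ≈⟨ *-assoc _ _ _ ⟩
      D⁻¹ * (fromℕ D * S (suc n))    ≈⟨ *-congˡ (column-sum-closed-form n) ⟩
      D⁻¹ * closedForm (suc n)       ∎
    periodic : ∀ k → 1 ≤ k → S (k ℕ.+ L) ≈ S k
    periodic (suc n) _ = begin
      S (suc n ℕ.+ L)                ≈⟨ S≈ (n ℕ.+ L) ⟩
      D⁻¹ * closedForm (suc n ℕ.+ L) ≈⟨ *-congˡ (closedForm-periodic xᵐ≈1 m∣L 2∣L D∣L (suc n)) ⟩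
      D⁻¹ * closedForm (suc n)       ≈⟨ S≈ n ⟨
      S (suc n)                      ∎

proposition18 : ∀ {c ℓ : Level} (R : CommutativeRing c ℓ) →
  let open CommutativeRing R
      open Series R
  in (d : ℕ) → 2 ≤ d → (a : Carrier) → (m : ℕ) → 0 < m →
     pow (fromℕ (suc d) * a) m ≈ 1# →
     (∀ m′ → 0 < m′ → pow (fromℕ (suc d) * a) m′ ≈ 1# → m ≤ m′) →
     (d % 2 ≡ 1 → EventuallyPeriodic (colPartialSum d (pPoly d a)) (lcm m (suc d)))
     × (d % 2 ≡ 0 → EventuallyPeriodic (colPartialSum d (pPoly d a)) (lcm m (2 ℕ.* suc d)))
proposition18 R zero ()
proposition18 R (suc e) _ a m 0<m xᵐ≈1 _ =
    (λ d-odd → column-sums-periodic 0<m xᵐ≈1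
                 (m∣lcm[m,n] m D) (∣-trans (2∣1+odd d-odd) (n∣lcm[m,n] m D)) (n∣lcm[m,n] m D))
  , (λ _ → column-sums-periodic 0<m xᵐ≈1
             (m∣lcm[m,n] m (2 ℕ.* D)) (∣-trans (m∣m*n D) (n∣lcm[m,n] m (2 ℕ.* D)))
             (∣-trans (n∣m*n 2) (n∣lcm[m,n] m (2 ℕ.* D))))
  where
  open ColumnSums R e a
  2∣1+odd : ∀ {n} → n % 2 ≡ 1 → 2 ∣ suc n
  2∣1+odd {n} n-odd =
    m%n≡0⇒n∣m (suc n) 2 (≡.trans (%-distribˡ-+ 1 n 2) (≡.cong (λ r → (1 ℕ.+ r) % 2) n-odd))
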